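{- Let $L$ be a finite semidistrim lattice and $z\in L$. Then $z$ lies in the image of $\mathsf{Pop}^\downarrow_L$ if and only if there exists $y\in L$ such that $(z,y)$ is a popping pair; and $z$ lies in the image of $\mathsf{Pop}^\uparrow_L$ if and only if there exists $x\in L$ such that $(x,z)$ is a popping pair.
   Context: All lattices are finite. For a lattice $L$, $\mathcal{J}_L$ (resp. $\mathcal{M}_L$) is the set of join-irreducible (resp. meet-irreducible) elements; for $j\in\mathcal{J}_L$, $j_*$ is the unique element covered by $j$, and for $m\in\mathcal{M}_L$, $m^*$ is the unique element covering $m$. Let $\mathcal{M}_L(j)=\max\{z\in L: j_*=j\wedge z\}$ and $\mathcal{J}_L(m)=\min\{z\in L: m^*=m\vee z\}$. A pairing on $L$ is a bijection $\kappa:\mathcal{J}_L\to\mathcal{M}_L$ with $\kappa(j)\in\mathcal{M}_L(j)$ for all $j$ and $\kappa^{ -1}(m)\in\mathcal{J}_L(m)$ for all $m$; $L$ is uniquely paired if it has exactly one pairing, denoted $\kappa_L$. A prime pair is a pair $(j_0,m_0)$ with $L=[\hat0,m_0]\sqcup[j_0,\hat1]$. A uniquely paired lattice $L$ is compatibly dismantlable if $|L|=1$ or there is a prime pair $(j_0,m_0)$ such that: (i) $[j_0,\hat1]$ is compatibly dismantlable and $\alpha(j)=j_0\vee j$ defines a bijection $\{j\in\mathcal{J}_L: j_0\le\kappa_L(j)\}\to\mathcal{J}_{[j_0,\hat1]}$ with $\kappa_{[j_0,\hat1]}(\alpha(j))=\kappa_L(j)$; (ii) $[\hat0,m_0]$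 is compatibly dismantlable and $\beta(m)=m_0\wedge m$ defines a bijection $\{m\in\mathcal{M}_L:\kappa_L^{ -1}(m)\le m_0\}\to\mathcal{M}_{[\hat0,m_0]}$ with $\kappa_{[\hat0,m_0]}^{ -1}(\beta(m))=\kappa_L^{ -1}(m)$. The Galois graph $G_L$ is the directed graph on $\mathcal{J}_L$ with an edge $j\to j'$ iff $j\ne j'$ and $j\not\le\kappa_L(j')$. For $x\in L$ let $J_L(x)=\{j\in\mathcal{J}_L:j\le x\}$ and $M_L(x)=\{j\in\mathcal{J}_L:\kappa_L(j)\ge x\}$. For a compatibly dismantlable $L$, for every cover $x\lessdot y$ the set $M_L(x)\cap J_L(y)$ has exactly one element $j_{xy}$; set $\mathcal{D}_L(x)=\{j_{yx}:y\lessdot x\}$ and $\mathcal{U}_L(x)=\{j_{xy}:x\lessdot y\}$. $L$ is semidistrim if it is compatibly dismantlable and $\mathcal{D}_L(x)$, $\mathcal{U}_L(x)$ are independent sets (no two elements adjacent) of $G_L$ for all $x\in L$. $\mathsf{Pop}^\downarrow_L(x)=x\wedge\bigwedge\{y:y\lessdot x\}$ and $\mathsf{Pop}^\uparrow_L(x)=x\vee\bigvee\{y:x\lessdot y\}$. A pair $(x,y)$ of elements of $L$ is a popping pair if $\mathsf{Pop}^\uparrow_L(x)=y$ and $\mathsf{Pop}^\downarrow_L(y)=x$. -}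

module Defs where

open import Data.List using (List)
open import Data.List.Membership.Propositional using (_∈_)
open import Data.Product using (Σ; ∃; _×_; _,_)
open import Data.Sum using (_⊎_)
open import Data.Empty using (⊥)
open import Relation.Nullary using (¬_)
open import Relation.Binary.Core using (Rel)
open import Relation.Binary.Definitions using (Decidable)
open import Relation.Binary.PropositionalEquality using (_≡_)
open import Relation.Binary.Lattice.Structures using (IsBoundedLattice)

-- Elements are compared with propositional equality;
-- finiteness is an explicit list enumerating all elements, and the order
-- is decidable (automatic classically for a finite structure).
-- A finite (nonempty) lattice is bounded, so bounds are included.

record FiniteLattice : Set₁ where
  infixr 6 _∨_
  infixr 7 _∧_
  infix  4 _≤_
  field
    Carrier          : Set
    _≤_              : Rel Carrier _
    _∨_              : Carrier → Carrier → Carrier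
    _∧_              : Carrier → Carrier → Carrier
    top              : Carrier
    bot              : Carrier
    isBoundedLattice : IsBoundedLattice _≡_ _≤_ _∨_ _∧_ top bot
    elements         : List Carrier
    complete         : ∀ x → x ∈ elements
    _≤?_             : Decidable _≤_

module _ (L : FiniteLattice) where
  open FiniteLattice L

  infix 4 _<_ _⋖_

  _<_ : Carrier → Carrier → Set
  x < y = x ≤ y × ¬ (x ≡ y)

  _⋖_ : Carrier → Carrier → Set
  x ⋖ y = x < y × (∀ z → x < z → z < y → ⊥)

  -- Everything below is relative to an interval [a , b] of L, viewed as a
  -- lattice in its own right (its order, meets, joins and covers are those
  -- of L restricted to [a , b]).  The whole lattice is [bot , top].

  InI : Carrier → Carrier → Carrier → Set
  InI a b x = a ≤ x × x ≤ b

  IsLowerStar : Carrier → Carrier → Carrier → Carrier → Set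
  IsLowerStar a b j s = InI a b s × s ⋖ j × (∀ y → InI a b y → y ⋖ j → y ≡ s)

  IsUpperStar : Carrier → Carrier → Carrier → Carrier → Set
  IsUpperStar a b m s = InI a b s × m ⋖ s × (∀ y → InI a b y → m ⋖ y → y ≡ s)

  JI : Carrier → Carrier → Carrier → Set
  JI a b j = InI a b j × ∃ (IsLowerStar a b j)

  MI : Carrier → Carrier → Carrier → Set
  MI a b m = InI a b m × ∃ (IsUpperStar a b m)

  IsMax : (Carrier → Set) → Carrier → Set
  IsMax P z = P z × (∀ w → P w → z < w → ⊥)

  IsMin : (Carrier → Set) → Carrier → Set
  IsMin P z = P z × (∀ w → P w → w < z → ⊥)

  InMof : Carrier → Carrier → Carrier → Carrier → Set
  InMof a b j z = ∀ s → IsLowerStar a b j s → IsMax (λ w → InI a b w × s ≡ j ∧ w) z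

  InJof : Carrier → Carrier → Carrier → Carrier → Set
  InJof a b m z = ∀ s → IsUpperStar a b m s → IsMin (λ w → InI a b w × s ≡ m ∨ w) z

  -- A pairing of [a,b]: a function κ restricting to a bijection
  -- JI[a,b] → MI[a,b] with κ(j) ∈ M(j) and κ⁻¹(m) ∈ J(m).
  -- (Values of κ outside JI[a,b] are irrelevant.)
  IsPairing : Carrier → Carrier → (Carrier → Carrier) → Set
  IsPairing a b κ =
      (∀ j → JI a b j → MI a b (κ j))
    × (∀ j j' → JI a b j → JI a b j' → κ j ≡ κ j' → j ≡ j')
    × (∀ m → MI a b m → ∃ λ j → JI a b j × κ j ≡ m)
    × (∀ j → JI a b j → InMof a b j (κ j))
    × (∀ j → JI a b j → InJof a b (κ j) j)

  IsUniquePairing : Carrier → Carrier → (Carrier → Carrier) → Set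
  IsUniquePairing a b κ =
    IsPairing a b κ × (∀ κ' → IsPairing a b κ' → ∀ j → JI a b j → κ' j ≡ κ j)

  IsPrimePair : Carrier → Carrier → Carrier → Carrier → Set
  IsPrimePair a b j0 m0 =
      InI a b j0 × InI a b m0
    × (∀ x → InI a b x → x ≤ m0 ⊎ j0 ≤ x)
    × (∀ x → InI a b x → x ≤ m0 → j0 ≤ x → ⊥)

  CondUp : Carrier → Carrier → (Carrier → Carrier) → Carrier → (Carrier → Carrier) → Set
  CondUp a b κ j0 κu =
      (∀ j → JI a b j → j0 ≤ κ j → JI j0 b (j0 ∨ j) × κu (j0 ∨ j) ≡ κ j)
    × (∀ j j' → JI a b j → j0 ≤ κ j → JI a b j' → j0 ≤ κ j' → j0 ∨ j ≡ j0 ∨ j' → j ≡ j')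
    × (∀ j' → JI j0 b j' → ∃ λ j → JI a b j × j0 ≤ κ j × j0 ∨ j ≡ j')

  DomDown : Carrier → Carrier → (Carrier → Carrier) → Carrier → Carrier → Set
  DomDown a b κ m0 m = MI a b m × ∃ λ j → JI a b j × κ j ≡ m × j ≤ m0

  -- Condition (ii): β(m) = m0 ∧ m is a bijection
  --   {m ∈ MI[a,b] : κ⁻¹(m) ≤ m0} → MI[a,m0]   with κd⁻¹(β m) = κ⁻¹(m),
  -- where "κd⁻¹(β m) = j" means j ∈ JI[a,m0] and κd j = β m.
  CondDown : Carrier → Carrier → (Carrier → Carrier) → Carrier → (Carrier → Carrier) → Set
  CondDown a b κ m0 κd =
      (∀ m j → MI a b m → JI a b j → κ j ≡ m → j ≤ m0 →
         MI a m0 (m0 ∧ m) × JI a m0 j × κd j ≡ m0 ∧ m)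
    × (∀ m m' → DomDown a b κ m0 m → DomDown a b κ m0 m' → m0 ∧ m ≡ m0 ∧ m' → m ≡ m')
    × (∀ m' → MI a m0 m' → ∃ λ m → DomDown a b κ m0 m × m0 ∧ m ≡ m')

  -- CD a b κ : [a,b] is uniquely paired, with unique pairing κ, and is
  -- compatibly dismantlable.
  data CD : Carrier → Carrier → (Carrier → Carrier) → Set where
    single : ∀ {a b κ} → IsUniquePairing a b κ → a ≡ b → CD a b κ
    step   : ∀ {a b κ} → IsUniquePairing a b κ →
             (j0 m0 : Carrier) (κu κd : Carrier → Carrier) →
             IsPrimePair a b j0 m0 →
             CD j0 b κu → CondUp a b κ j0 κu →
             CD a m0 κd → CondDown a b κ m0 κd →
             CD a b κ

  GEdge : (Carrier → Carrier) → Carrier → Carrier → Set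
  GEdge κ j j' = ¬ (j ≡ j') × ¬ (j ≤ κ j')

  Independent : (Carrier → Carrier) → (Carrier → Set) → Set
  Independent κ S = ∀ j j' → S j → S j' → GEdge κ j j' → ⊥

  -- j ∈ M_L(x) ∩ J_L(y)   (for a cover x ⋖ y this is j = j_{xy})
  InMJ : (Carrier → Carrier) → Carrier → Carrier → Carrier → Set
  InMJ κ x y j = JI bot top j × x ≤ κ j × j ≤ y

  InDset : (Carrier → Carrier) → Carrier → Carrier → Set
  InDset κ x j = ∃ λ y → y ⋖ x × InMJ κ y x j

  InUset : (Carrier → Carrier) → Carrier → Carrier → Set
  InUset κ x j = ∃ λ y → x ⋖ y × InMJ κ x y j

  Semidistrim : Set
  Semidistrim = ∃ λ κ → CD bot top κ ×
    (∀ x → Independent κ (InDset κ x) × Independent κ (InUset κ x))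

  -- Pop↓(x) = x ∧ ⋀{y : y ⋖ x} and Pop↑(x) = x ∨ ⋁{y : x ⋖ y},
  -- as relations "p is the meet (resp. join) of x and its lower (upper) covers".

  PopDownIs : Carrier → Carrier → Set
  PopDownIs x p =
      p ≤ x × (∀ y → y ⋖ x → p ≤ y)
    × (∀ w → w ≤ x → (∀ y → y ⋖ x → w ≤ y) → w ≤ p)

  PopUpIs : Carrier → Carrier → Set
  PopUpIs x p =
      x ≤ p × (∀ y → x ⋖ y → y ≤ p)
    × (∀ w → x ≤ w → (∀ y → x ⋖ y → y ≤ w) → p ≤ w)

  PoppingPair : Carrier → Carrier → Set
  PoppingPair x y = PopUpIs x y × PopDownIs y x

module Submission where

-- Every cover w ⋖ x of a compatibly dismantlable lattice has a label: a join-irreducible j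
-- with w ≤ κ j and j ≤ x, and then w = x ∧ κ j and x = w ∨ j; D(x) and U(x) are the labels of
-- the covers below and above x.  Dismantling along prime pairs shows that x ∧ κ j ⋖ (x ∧ κ j) ∨ j
-- whenever j ≤ x, and dually.  With the independence of D(x) and U(x) this gives
-- D(x) ⊆ U(Pop↓ x) and U(x) ⊆ D(Pop↑ x).  So if z = Pop↓ x and y = Pop↑ z then
-- D(x) ⊆ U(z) ⊆ D(y); independence of D(y) forces z ≤ κ j for all j ∈ D(y), so z lies below
-- every lower cover of y, while U(z) ⊆ D(y) shows that every element below all lower covers of y
-- lies below z.  Hence Pop↓ y = z.  The statement about Pop↑ is dual.

open import Defs hiding (_<_; _⋖_)
open import Data.Empty using (⊥; ⊥-elim)
open import Data.List using (List; []; _∷_; foldr; filter)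
open import Data.List.Membership.Propositional using (_∈_; lose)
open import Data.List.Membership.Propositional.Properties using (∈-filter⁺; ∈-filter⁻)
open import Data.List.Relation.Unary.Any using (here; there; any?; satisfied)
open import Data.Product using (∃; ∃-syntax; _×_; _,_; proj₁; proj₂)
open import Data.Sum using (_⊎_; inj₁; inj₂; [_,_]; fromInj₁; fromInj₂)
open import Function.Base using (_∘_)
open import Function.Bundles using (_⇔_; mk⇔)
open import Relation.Binary.Bundles using (Poset)
open import Relation.Binary.Core using (Rel)
open import Relation.Binary.Definitions using (Decidable; Transitive)
open import Relation.Binary.Lattice.Structures using (IsBoundedLattice)
open import Relation.Binary.PropositionalEquality
  using (_≡_; _≢_; refl; sym; trans; cong; cong₂; subst; subst₂)
open import Relation.Nullary using (¬_; Dec; yes; no; contradiction)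
open import Relation.Nullary.Decidable using (_×-dec_; decidable-stable)
import Relation.Binary.Construct.NonStrictToStrict as ToStrict

module _ {A : Set} {ℓ} {_⊏_ : Rel A ℓ} (⊏-trans : Transitive _⊏_) (⊏-irrefl : ∀ {x} → ¬ x ⊏ x)
         (_⊏?_ : Decidable _⊏_) {P : A → Set} (P? : ∀ x → Dec (P x)) where

  -- The scan only ever replaces its candidate by a ⊏-larger one, so by transitivity elements
  -- rejected earlier stay rejected.
  maximal-∈ : ∀ xs {a} → P a → ∃[ m ] P m × (∀ {e} → e ∈ xs → P e → ¬ m ⊏ e)
  maximal-∈ [] pa = _ , pa , λ ()
  maximal-∈ (e ∷ xs) pa with maximal-∈ xs pa
  ... | m , pm , maximal with P? e | m ⊏? e
  ...   | yes pe | yes m⊏e = e , pe , λ { (here refl) _ → ⊏-irrefl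
                                        ; (there e'∈) pe' e⊏e' → maximal e'∈ pe' (⊏-trans m⊏e e⊏e') }
  ...   | _      | no m⊀e  = m , pm , λ { (here refl) _ → m⊀e ; (there e'∈) → maximal e'∈ }
  ...   | no ¬pe | yes _   = m , pm , λ { (here refl) pe → contradiction pe ¬pe
                                        ; (there e'∈) → maximal e'∈ }

module _ (L : FiniteLattice) where
  open FiniteLattice L
  open IsBoundedLattice isBoundedLattice
    using ( isPartialOrder; antisym; x≤x∨y; y≤x∨y; ∨-least; x∧y≤x; x∧y≤y; ∧-greatest
          ; maximum; minimum )
    renaming (refl to ≤-refl; trans to ≤-trans)

  poset : Poset _ _ _
  poset = record { isPartialOrder = isPartialOrder }

  -- This strict order is definitionally Defs._<_ L.
  open import Relation.Binary.Properties.Poset poset using (_<_; <-trans; <-irrefl; <⇒≱; ≤-dec⇒≈-dec)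

  infix 4 _⋖_
  _⋖_ : Carrier → Carrier → Set
  _⋖_ = Defs._⋖_ L

  ⋖⇒≤ : ∀ {x y} → x ⋖ y → x ≤ y
  ⋖⇒≤ ((x≤y , _) , _) = x≤y

  _≟_ : Decidable _≡_
  _≟_ = ≤-dec⇒≈-dec _≤?_

  _<?_ : Decidable _<_
  _<?_ = ToStrict.<-decidable _≡_ _≤_ _≟_ _≤?_

  _⋖?_ : Decidable _⋖_
  x ⋖? y with x <? y | any? (λ z → (x <? z) ×-dec (z <? y)) elements
  ... | no x≮y  | _            = no (x≮y ∘ proj₁)
  ... | yes x<y | no noneBtw   = yes (x<y , λ z x<z z<y → noneBtw (lose (complete z) (x<z , z<y)))
  ... | yes _   | yes someBtw  = let (z , x<z , z<y) = satisfied someBtw in no λ (_ , gap) → gap z x<z z<y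

  cover-below : ∀ {x y} → x < y → ∃[ c ] x ≤ c × c ⋖ y
  cover-below {x} {y} x<y
    with maximal-∈ <-trans (<-irrefl refl) _<?_ (λ c → (x ≤? c) ×-dec (c <? y)) elements (≤-refl , x<y)
  ... | c , (x≤c , c<y) , maximal =
    c , x≤c , c<y , λ z c<z z<y → maximal (complete z) (≤-trans x≤c (proj₁ c<z) , z<y) c<z

  cover-above : ∀ {x y} → x < y → ∃[ c ] x ⋖ c × c ≤ y
  cover-above {x} {y} x<y
    with maximal-∈ (λ j<i k<j → <-trans k<j j<i) (<-irrefl refl) (λ i j → j <? i)
                   (λ c → (x <? c) ×-dec (c ≤? y)) elements (x<y , ≤-refl)
  ... | c , (x<c , c≤y) , minimal =
    c , (x<c , λ z x<z z<c → minimal (complete z) (x<z , ≤-trans (proj₁ z<c) c≤y) z<c) , c≤y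

  ⋖-squeeze : ∀ {w x v} → w ⋖ x → w ≤ v → v ≤ x → v ≡ w ⊎ v ≡ x
  ⋖-squeeze {w} {x} {v} (_ , gap) w≤v v≤x with v ≟ w | v ≟ x
  ... | yes v≡w | _       = inj₁ v≡w
  ... | no _    | yes v≡x = inj₂ v≡x
  ... | no v≢w  | no v≢x  = ⊥-elim (gap v (w≤v , v≢w ∘ sym) (v≤x , v≢x))

  InI-∨ : ∀ {a b x y} → InI L a b x → InI L a b y → InI L a b (x ∨ y)
  InI-∨ (a≤x , x≤b) (_ , y≤b) = ≤-trans a≤x (x≤x∨y _ _) , ∨-least x≤b y≤b

  x≤y⇒x∧y≡x : ∀ {x y} → x ≤ y → x ∧ y ≡ x
  x≤y⇒x∧y≡x x≤y = antisym (x∧y≤x _ _) (∧-greatest ≤-refl x≤y)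

  x≤m⇒x∧[m∧k]≡x∧k : ∀ {x m k} → x ≤ m → x ∧ (m ∧ k) ≡ x ∧ k
  x≤m⇒x∧[m∧k]≡x∧k x≤m =
    antisym (∧-greatest (x∧y≤x _ _) (≤-trans (x∧y≤y _ _) (x∧y≤y _ _)))
            (∧-greatest (x∧y≤x _ _) (∧-greatest (≤-trans (x∧y≤x _ _) x≤m) (x∧y≤y _ _)))

  k≤m⇒[x∧m]∧[m∧k]≡x∧k : ∀ {x m k} → k ≤ m → (x ∧ m) ∧ (m ∧ k) ≡ x ∧ k
  k≤m⇒[x∧m]∧[m∧k]≡x∧k k≤m =
    antisym (∧-greatest (≤-trans (x∧y≤x _ _) (x∧y≤x _ _)) (≤-trans (x∧y≤y _ _) (x∧y≤y _ _)))
            (∧-greatest (∧-greatest (x∧y≤x _ _) (≤-trans (x∧y≤y _ _) k≤m))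
                        (∧-greatest (≤-trans (x∧y≤y _ _) k≤m) (x∧y≤y _ _)))

  c≤x∨y⇒[x∨c]∨[c∨y]≡x∨y : ∀ {x c y} → c ≤ x ∨ y → (x ∨ c) ∨ (c ∨ y) ≡ x ∨ y
  c≤x∨y⇒[x∨c]∨[c∨y]≡x∨y c≤x∨y =
    antisym (∨-least (∨-least (x≤x∨y _ _) c≤x∨y) (∨-least c≤x∨y (y≤x∨y _ _)))
            (∨-least (≤-trans (x≤x∨y _ _) (x≤x∨y _ _)) (≤-trans (y≤x∨y _ _) (y≤x∨y _ _)))

  c≤x⇒x∨[c∨y]≡x∨y : ∀ {x c y} → c ≤ x → x ∨ (c ∨ y) ≡ x ∨ y
  c≤x⇒x∨[c∨y]≡x∨y c≤x =
    antisym (∨-least (x≤x∨y _ _) (∨-least (≤-trans c≤x (x≤x∨y _ _)) (y≤x∨y _ _)))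
            (∨-least (x≤x∨y _ _) (≤-trans (y≤x∨y _ _) (y≤x∨y _ _)))

  ⋀ : List Carrier → Carrier
  ⋀ = foldr _∧_ top

  ⋀-lowerBound : ∀ {x xs} → x ∈ xs → ⋀ xs ≤ x
  ⋀-lowerBound (here refl) = x∧y≤x _ _
  ⋀-lowerBound (there x∈)  = ≤-trans (x∧y≤y _ _) (⋀-lowerBound x∈)

  ⋀-greatest : ∀ {w} xs → (∀ {x} → x ∈ xs → w ≤ x) → w ≤ ⋀ xs
  ⋀-greatest []       _     = maximum _
  ⋀-greatest (x ∷ xs) lower = ∧-greatest (lower (here refl)) (⋀-greatest xs (lower ∘ there))

  ⋁ : List Carrier → Carrier
  ⋁ = foldr _∨_ bot

  ⋁-upperBound : ∀ {x xs} → x ∈ xs → x ≤ ⋁ xs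
  ⋁-upperBound (here refl) = x≤x∨y _ _
  ⋁-upperBound (there x∈)  = ≤-trans (⋁-upperBound x∈) (y≤x∨y _ _)

  ⋁-least : ∀ {w} xs → (∀ {x} → x ∈ xs → x ≤ w) → ⋁ xs ≤ w
  ⋁-least []       _     = minimum _
  ⋁-least (x ∷ xs) upper = ∨-least (upper (here refl)) (⋁-least xs (upper ∘ there))

  popDown-exists : ∀ x → ∃ (PopDownIs L x)
  popDown-exists x =
      x ∧ ⋀ lowerCovers
    , x∧y≤x _ _
    , (λ y y⋖x → ≤-trans (x∧y≤y _ _) (⋀-lowerBound (∈-filter⁺ (_⋖? x) (complete y) y⋖x)))
    , λ w w≤x below → ∧-greatest w≤x (⋀-greatest lowerCovers λ y∈ →
        below _ (proj₂ (∈-filter⁻ (_⋖? x) {xs = elements} y∈)))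
    where
      lowerCovers : List Carrier
      lowerCovers = filter (_⋖? x) elements

  popUp-exists : ∀ x → ∃ (PopUpIs L x)
  popUp-exists x =
      x ∨ ⋁ upperCovers
    , x≤x∨y _ _
    , (λ y x⋖y → ≤-trans (⋁-upperBound (∈-filter⁺ (x ⋖?_) (complete y) x⋖y)) (y≤x∨y _ _))
    , λ w x≤w above → ∨-least x≤w (⋁-least upperCovers λ y∈ →
        above _ (proj₂ (∈-filter⁻ (x ⋖?_) {xs = elements} y∈)))
    where
      upperCovers : List Carrier
      upperCovers = filter (x ⋖?_) elements

  module Pairing {a b : Carrier} {κ : Carrier → Carrier} (pairing : IsPairing L a b κ) where

    κ-MI : ∀ {j} → JI L a b j → MI L a b (κ j)
    κ-MI = proj₁ pairing _

    κ-injective : ∀ {j j'} → JI L a b j → JI L a b j' → κ j ≡ κ j' → j ≡ j'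
    κ-injective = proj₁ (proj₂ pairing) _ _

    κ-maximal : ∀ {j s} → JI L a b j → IsLowerStar L a b j s →
                IsMax L (λ w → InI L a b w × s ≡ j ∧ w) (κ j)
    κ-maximal J star = proj₁ (proj₂ (proj₂ (proj₂ pairing))) _ J _ star

    lowerStar≡j∧κj : ∀ {j s} → JI L a b j → IsLowerStar L a b j s → s ≡ j ∧ κ j
    lowerStar≡j∧κj J star = proj₂ (proj₁ (κ-maximal J star))

    κ-irreflexive : ∀ {j} → JI L a b j → ¬ j ≤ κ j
    κ-irreflexive J@(_ , _ , star@(_ , (s<j , _) , _)) j≤κj =
      <-irrefl (trans (lowerStar≡j∧κj J star) (x≤y⇒x∧y≡x j≤κj)) s<j

    <⇒≤lowerStar : ∀ {j s w} → InI L a b j → IsLowerStar L a b j s →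
                   InI L a b w → w < j → w ≤ s
    <⇒≤lowerStar {w = w} (_ , j≤b) (_ , _ , unique) (a≤w , _) w<j =
      let (c , w≤c , c⋖j) = cover-below w<j
      in subst (w ≤_) (unique c (≤-trans a≤w w≤c , ≤-trans (⋖⇒≤ c⋖j) j≤b) c⋖j) w≤c

    ⋖⇒∧κ≡ : ∀ {w x j} → JI L a b j → w ⋖ x → w ≤ κ j → j ≤ x → x ∧ κ j ≡ w
    ⋖⇒∧κ≡ J w⋖x w≤κj j≤x =
      fromInj₁ (λ x∧κj≡x →
                 ⊥-elim (κ-irreflexive J (≤-trans (subst (_ ≤_) (sym x∧κj≡x) j≤x) (x∧y≤y _ _))))
      (⋖-squeeze w⋖x (∧-greatest (⋖⇒≤ w⋖x) w≤κj) (x∧y≤x _ _))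

    ⋖⇒∨≡ : ∀ {x v j} → JI L a b j → x ⋖ v → x ≤ κ j → j ≤ v → x ∨ j ≡ v
    ⋖⇒∨≡ J x⋖v x≤κj j≤v =
      fromInj₂ (λ x∨j≡x →
                 ⊥-elim (κ-irreflexive J (≤-trans (subst (_ ≤_) x∨j≡x (y≤x∨y _ _)) x≤κj)))
      (⋖-squeeze x⋖v (x≤x∨y _ _) (∨-least (⋖⇒≤ x⋖v) j≤v))

  module PrimePair {a b j0 m0 : Carrier} {κ : Carrier → Carrier}
                   (pairing : IsPairing L a b κ) (prime : IsPrimePair L a b j0 m0) where
    open Pairing pairing

    j0∈ : InI L a b j0
    j0∈ = proj₁ prime

    m0∈ : InI L a b m0
    m0∈ = proj₁ (proj₂ prime)

    split : ∀ {x} → InI L a b x → x ≤ m0 ⊎ j0 ≤ x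
    split = proj₁ (proj₂ (proj₂ prime)) _

    disjoint : ∀ {x} → InI L a b x → x ≤ m0 → j0 ≤ x → ⊥
    disjoint = proj₂ (proj₂ (proj₂ prime)) _

    j0≰m0 : ¬ j0 ≤ m0
    j0≰m0 j0≤m0 = disjoint j0∈ j0≤m0 ≤-refl

    <j0⇒≤m0 : ∀ {x} → InI L a b x → x < j0 → x ≤ m0
    <j0⇒≤m0 x∈ (x≤j0 , x≢j0) = fromInj₁ (λ j0≤x → ⊥-elim (x≢j0 (antisym x≤j0 j0≤x))) (split x∈)

    lowerCovers-of-j0-≤ : ∀ {c d} → InI L a b c → InI L a b d → c ⋖ j0 → d ⋖ j0 → c ≤ d
    lowerCovers-of-j0-≤ {c} {d} c∈ d∈ c⋖j0@(c<j0 , _) d⋖j0@(d<j0 , _) =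
      subst (_ ≤_) c∨d≡d (x≤x∨y _ _)
      where
        c∨d≢j0 : c ∨ d ≢ j0
        c∨d≢j0 c∨d≡j0 =
          j0≰m0 (subst (_≤ m0) c∨d≡j0 (∨-least (<j0⇒≤m0 c∈ c<j0) (<j0⇒≤m0 d∈ d<j0)))
        c∨d≡d : c ∨ d ≡ d
        c∨d≡d = fromInj₁ (⊥-elim ∘ c∨d≢j0)
                         (⋖-squeeze d⋖j0 (y≤x∨y _ _) (∨-least (⋖⇒≤ c⋖j0) (⋖⇒≤ d⋖j0)))

    j0-lowerStar : ∃ (IsLowerStar L a b j0)
    j0-lowerStar =
      let a<j0 = proj₁ j0∈ , λ a≡j0 → j0≰m0 (subst (_≤ m0) a≡j0 (proj₁ m0∈))
          (c , a≤c , c⋖j0) = cover-below a<j0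
          c∈ = a≤c , ≤-trans (⋖⇒≤ c⋖j0) (proj₂ j0∈)
      in c , c∈ , c⋖j0 , λ d d∈ d⋖j0 →
           antisym (lowerCovers-of-j0-≤ d∈ c∈ d⋖j0 c⋖j0) (lowerCovers-of-j0-≤ c∈ d∈ c⋖j0 d⋖j0)

    j0-JI : JI L a b j0
    j0-JI = j0∈ , j0-lowerStar

    lowerStar≡j0∧m0 : ∀ {c} → IsLowerStar L a b j0 c → c ≡ j0 ∧ m0
    lowerStar≡j0∧m0 star@(c∈ , c⋖j0@(c<j0 , _) , _) =
      antisym (∧-greatest (⋖⇒≤ c⋖j0) (<j0⇒≤m0 c∈ c<j0))
              (<⇒≤lowerStar j0∈ star j0∧m0∈ j0∧m0<j0)
      where
        j0∧m0<j0 : j0 ∧ m0 < j0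
        j0∧m0<j0 = x∧y≤x _ _ , λ j0∧m0≡j0 → j0≰m0 (subst (_≤ m0) j0∧m0≡j0 (x∧y≤y _ _))
        j0∧m0∈ : InI L a b (j0 ∧ m0)
        j0∧m0∈ = ∧-greatest (proj₁ j0∈) (proj₁ m0∈) , ≤-trans (x∧y≤x _ _) (proj₂ j0∈)

    κ[j0]≡m0 : κ j0 ≡ m0
    κ[j0]≡m0 =
      let (c , star) = j0-lowerStar
          ((κj0∈ , _) , maximal) = κ-maximal j0-JI star
          κj0≤m0 = fromInj₁ (⊥-elim ∘ κ-irreflexive j0-JI) (split κj0∈)
      in decidable-stable (κ j0 ≟ m0) λ κj0≢m0 →
           maximal m0 (m0∈ , lowerStar≡j0∧m0 star) (κj0≤m0 , κj0≢m0)

    j0-unique : ∀ {j} → JI L a b j → j0 ≤ j → κ j ≤ m0 → j ≡ j0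
    j0-unique {j} J@(j∈ , _ , star) j0≤j κj≤m0 = decidable-stable (j ≟ j0) λ j≢j0 →
      j0≰m0 (≤-trans (<⇒≤lowerStar j∈ star j0∈ (j0≤j , j≢j0 ∘ sym))
                     (≤-trans (subst (_≤ κ j) (sym (lowerStar≡j∧κj J star)) (x∧y≤y _ _)) κj≤m0))

    κ≤m0⇒≡j0 : ∀ {j x} → JI L a b j → InI L a b x → x ≤ κ j → κ j ≤ m0 →
               j0 ≤ x ∨ j → j ≡ j0
    κ≤m0⇒≡j0 J x∈ x≤κj κj≤m0 j0≤x∨j =
      [ (λ j≤m0 → ⊥-elim (disjoint (InI-∨ x∈ (proj₁ J)) (∨-least (≤-trans x≤κj κj≤m0) j≤m0)
                                   j0≤x∨j))
      , (λ j0≤j → j0-unique J j0≤j κj≤m0)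
      ] (split (proj₁ J))

    [x∨j0]∧m0⋖x∨j0 : ∀ {x} → InI L a b x → x ≤ m0 → (x ∨ j0) ∧ m0 ⋖ x ∨ j0
    [x∨j0]∧m0⋖x∨j0 {x} x∈ x≤m0 =
      (x∧y≤x _ _ , λ y∧m0≡y → y≰m0 (subst (_≤ m0) y∧m0≡y (x∧y≤y _ _))) , gap
      where
        y∈ : InI L a b (x ∨ j0)
        y∈ = InI-∨ x∈ j0∈
        y≰m0 : ¬ x ∨ j0 ≤ m0
        y≰m0 y≤m0 = j0≰m0 (≤-trans (y≤x∨y _ _) y≤m0)
        gap : ∀ z → (x ∨ j0) ∧ m0 < z → z < x ∨ j0 → ⊥
        gap z below<z z<y@(z≤y , _) =
          [ (λ z≤m0 → <⇒≱ below<z (∧-greatest z≤y z≤m0))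
          , (λ j0≤z →
               <⇒≱ z<y (∨-least (≤-trans (∧-greatest (x≤x∨y _ _) x≤m0) (proj₁ below<z)) j0≤z))
          ] (split ( ≤-trans (∧-greatest (proj₁ y∈) (proj₁ m0∈)) (proj₁ below<z)
                   , ≤-trans z≤y (proj₂ y∈) ))

    x∧m0⋖[x∧m0]∨j0 : ∀ {x} → InI L a b x → j0 ≤ x → x ∧ m0 ⋖ (x ∧ m0) ∨ j0
    x∧m0⋖[x∧m0]∨j0 {x} (a≤x , x≤b) j0≤x =
      ( x≤x∨y _ _
      , λ w≡w∨j0 → j0≰m0 (≤-trans (subst (j0 ≤_) (sym w≡w∨j0) (y≤x∨y _ _)) (x∧y≤y _ _)))
      , gap
      where
        w∨j0≤x : (x ∧ m0) ∨ j0 ≤ x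
        w∨j0≤x = ∨-least (x∧y≤x _ _) j0≤x
        gap : ∀ z → x ∧ m0 < z → z < (x ∧ m0) ∨ j0 → ⊥
        gap z w<z@(w≤z , _) z<w∨j0@(z≤w∨j0 , _) =
          [ (λ z≤m0 → <⇒≱ w<z (∧-greatest (≤-trans z≤w∨j0 w∨j0≤x) z≤m0))
          , (λ j0≤z → <⇒≱ z<w∨j0 (∨-least w≤z j0≤z))
          ] (split ( ≤-trans (∧-greatest a≤x (proj₁ m0∈)) w≤z
                   , ≤-trans z≤w∨j0 (≤-trans w∨j0≤x x≤b) ))

  cd-pairing : ∀ {a b κ} → CD L a b κ → IsPairing L a b κ
  cd-pairing (single unique _)               = proj₁ unique
  cd-pairing (step unique _ _ _ _ _ _ _ _ _) = proj₁ unique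

  CoversLabelled : Carrier → Carrier → (Carrier → Carrier) → Set
  CoversLabelled a b κ =
    ∀ {x y} → InI L a b x → InI L a b y → x ⋖ y → ∃[ j ] JI L a b j × x ≤ κ j × j ≤ y

  JoinCovers : Carrier → Carrier → (Carrier → Carrier) → Set
  JoinCovers a b κ = ∀ {j x} → JI L a b j → InI L a b x → x ≤ κ j → (x ∨ j) ∧ κ j ⋖ x ∨ j

  MeetCovered : Carrier → Carrier → (Carrier → Carrier) → Set
  MeetCovered a b κ = ∀ {j x} → JI L a b j → InI L a b x → j ≤ x → x ∧ κ j ⋖ (x ∧ κ j) ∨ j

  module DismantlingStep {a b j0 m0 : Carrier} {κ κu κd : Carrier → Carrier}
                         (pairing : IsPairing L a b κ) (prime : IsPrimePair L a b j0 m0)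
                         (up : CondUp L a b κ j0 κu)
                         (pairing↓ : IsPairing L a m0 κd) (down : CondDown L a b κ m0 κd) where
    open Pairing pairing
    open PrimePair pairing prime

    JI⇒JI↓ : ∀ {j} → JI L a b j → j ≤ m0 → JI L a m0 j × κd j ≡ m0 ∧ κ j
    JI⇒JI↓ {j} J j≤m0 = let (_ , J↓ , κdj≡) = proj₁ down (κ j) j (κ-MI J) J refl j≤m0
                        in J↓ , κdj≡

    JI↓⇒JI : ∀ {j} → JI L a m0 j → JI L a b j × κd j ≡ m0 ∧ κ j
    JI↓⇒JI {j} J↓ =
      let (m , (_ , j' , J' , κj'≡m , j'≤m0) , m0∧m≡κdj) =
            proj₂ (proj₂ down) (κd j) (Pairing.κ-MI pairing↓ J↓)
          (J'↓ , κdj'≡) = JI⇒JI↓ J' j'≤m0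
          j'≡j = Pairing.κ-injective pairing↓ J'↓ J↓
                   (trans κdj'≡ (trans (cong (m0 ∧_) κj'≡m) m0∧m≡κdj))
      in subst (λ i → JI L a b i × κd i ≡ m0 ∧ κ i) j'≡j (J' , κdj'≡)

    JI⇒JI↑ : ∀ {j} → JI L a b j → j0 ≤ κ j → JI L j0 b (j0 ∨ j) × κu (j0 ∨ j) ≡ κ j
    JI⇒JI↑ J = proj₁ up _ J

    JI↑⇒JI : ∀ {j'} → JI L j0 b j' → ∃[ j ] JI L a b j × j0 ∨ j ≡ j' × κu j' ≡ κ j
    JI↑⇒JI J' =
      let (j , J , j0≤κj , j0∨j≡j') = proj₂ (proj₂ up) _ J'
      in j , J , j0∨j≡j' , subst (λ i → κu i ≡ κ j) j0∨j≡j' (proj₂ (JI⇒JI↑ J j0≤κj))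

    labelled : CoversLabelled a m0 κd → CoversLabelled j0 b κu → CoversLabelled a b κ
    labelled label↓ label↑ {x} {y} x∈@(a≤x , x≤b) y∈@(a≤y , y≤b) x⋖y with split y∈ | split x∈
    ... | inj₁ y≤m0 | _ =
      let (j , J↓ , x≤κdj , j≤y) = label↓ (a≤x , ≤-trans (⋖⇒≤ x⋖y) y≤m0) (a≤y , y≤m0) x⋖y
          (J , κdj≡) = JI↓⇒JI J↓
      in j , J , ≤-trans x≤κdj (subst (_≤ κ j) (sym κdj≡) (x∧y≤y _ _)) , j≤y
    ... | inj₂ j0≤y | inj₁ x≤m0 = j0 , j0-JI , subst (x ≤_) (sym κ[j0]≡m0) x≤m0 , j0≤y
    ... | inj₂ j0≤y | inj₂ j0≤x =
      let (j' , J' , x≤κuj' , j'≤y) = label↑ (j0≤x , x≤b) (j0≤y , y≤b) x⋖y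
          (j , J , j0∨j≡j' , κuj'≡κj) = JI↑⇒JI J'
      in j , J , subst (x ≤_) κuj'≡κj x≤κuj'
           , ≤-trans (y≤x∨y j0 j) (subst (_≤ y) (sym j0∨j≡j') j'≤y)

    joinCovers : JoinCovers a m0 κd → JoinCovers j0 b κu → JoinCovers a b κ
    joinCovers cover↓ cover↑ {j} {x} J x∈@(a≤x , x≤b) x≤κj
      with split (InI-∨ x∈ (proj₁ J)) | split (proj₁ (κ-MI J))
    ... | inj₁ y≤m0 | _ =
      let x≤m0 = ≤-trans (x≤x∨y _ _) y≤m0
          (J↓ , κdj≡) = JI⇒JI↓ J (≤-trans (y≤x∨y _ _) y≤m0)
      in subst (_⋖ x ∨ j) (trans (cong ((x ∨ j) ∧_) κdj≡) (x≤m⇒x∧[m∧k]≡x∧k y≤m0))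
               (cover↓ J↓ (a≤x , x≤m0) (subst (x ≤_) (sym κdj≡) (∧-greatest x≤m0 x≤κj)))
    ... | inj₂ j0≤y | inj₂ j0≤κj =
      let (J↑ , κu≡) = JI⇒JI↑ J j0≤κj
          y≡ = c≤x∨y⇒[x∨c]∨[c∨y]≡x∨y j0≤y
      in subst₂ _⋖_ (cong₂ _∧_ y≡ κu≡) y≡
           (cover↑ J↑ (y≤x∨y _ _ , ∨-least x≤b (proj₂ j0∈))
                      (subst (_ ≤_) (sym κu≡) (∨-least x≤κj j0≤κj)))
    ... | inj₂ j0≤y | inj₁ κj≤m0 with κ≤m0⇒≡j0 J x∈ x≤κj κj≤m0 j0≤y
    ...   | refl =
      subst (λ k → (x ∨ j0) ∧ k ⋖ x ∨ j0) (sym κ[j0]≡m0)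
            ([x∨j0]∧m0⋖x∨j0 x∈ (≤-trans x≤κj κj≤m0))

    meetCovered : MeetCovered a m0 κd → MeetCovered j0 b κu → MeetCovered a b κ
    meetCovered cover↓ cover↑ {j} {x} J x∈@(a≤x , x≤b) j≤x with split x∈ | split (proj₁ (κ-MI J))
    ... | inj₁ x≤m0 | _ =
      let (J↓ , κdj≡) = JI⇒JI↓ J (≤-trans j≤x x≤m0)
      in subst (λ w → w ⋖ w ∨ j) (trans (cong (x ∧_) κdj≡) (x≤m⇒x∧[m∧k]≡x∧k x≤m0))
               (cover↓ J↓ (a≤x , x≤m0) j≤x)
    ... | inj₂ j0≤x | inj₂ j0≤κj =
      let (J↑ , κu≡) = JI⇒JI↑ J j0≤κj
      in subst (x ∧ κ j ⋖_) (c≤x⇒x∨[c∨y]≡x∨y (∧-greatest j0≤x j0≤κj))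
           (subst (λ k → x ∧ k ⋖ (x ∧ k) ∨ (j0 ∨ j)) κu≡
                  (cover↑ J↑ (j0≤x , x≤b) (∨-least j0≤x j≤x)))
    ... | inj₂ j0≤x | inj₁ κj≤m0 with split (proj₁ J)
    ...   | inj₁ j≤m0 =
      let (J↓ , κdj≡) = JI⇒JI↓ J j≤m0
      in subst (λ w → w ⋖ w ∨ j)
               (trans (cong ((x ∧ m0) ∧_) κdj≡) (k≤m⇒[x∧m]∧[m∧k]≡x∧k κj≤m0))
           (cover↓ J↓ (∧-greatest a≤x (proj₁ m0∈) , x∧y≤y _ _) (∧-greatest j≤x j≤m0))
    ...   | inj₂ j0≤j with j0-unique J j0≤j κj≤m0
    ...     | refl =
      subst (λ k → x ∧ k ⋖ (x ∧ k) ∨ j0) (sym κ[j0]≡m0) (x∧m0⋖[x∧m0]∨j0 x∈ j0≤x)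

  no-JI-in-point : ∀ {a j} → ¬ JI L a a j
  no-JI-in-point ((a≤j , j≤a) , _ , (a≤s , _) , ((s≤j , s≢j) , _) , _) =
    s≢j (antisym s≤j (≤-trans j≤a a≤s))

  cd⇒labelled : ∀ {a b κ} → CD L a b κ → CoversLabelled a b κ
  cd⇒labelled (single _ refl) (a≤x , _) (_ , y≤a) (x<y , _) = ⊥-elim (<⇒≱ x<y (≤-trans y≤a a≤x))
  cd⇒labelled (step unique _ _ κu κd prime cd↑ up cd↓ down) =
    S.labelled (cd⇒labelled cd↓) (cd⇒labelled cd↑)
    where module S = DismantlingStep {κu = κu} {κd = κd} (proj₁ unique) prime up (cd-pairing cd↓) down

  cd⇒joinCovers : ∀ {a b κ} → CD L a b κ → JoinCovers a b κ
  cd⇒joinCovers (single _ refl) J = ⊥-elim (no-JI-in-point J)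
  cd⇒joinCovers (step unique _ _ κu κd prime cd↑ up cd↓ down) =
    S.joinCovers (cd⇒joinCovers cd↓) (cd⇒joinCovers cd↑)
    where module S = DismantlingStep {κu = κu} {κd = κd} (proj₁ unique) prime up (cd-pairing cd↓) down

  cd⇒meetCovered : ∀ {a b κ} → CD L a b κ → MeetCovered a b κ
  cd⇒meetCovered (single _ refl) J = ⊥-elim (no-JI-in-point J)
  cd⇒meetCovered (step unique _ _ κu κd prime cd↑ up cd↓ down) =
    S.meetCovered (cd⇒meetCovered cd↓) (cd⇒meetCovered cd↑)
    where module S = DismantlingStep {κu = κu} {κd = κd} (proj₁ unique) prime up (cd-pairing cd↓) down

  module CompatiblyDismantlable {κ : Carrier → Carrier} (cd : CD L bot top κ) where
    open Pairing (cd-pairing cd) public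

    whole : ∀ x → InI L bot top x
    whole x = minimum x , maximum x

    label : ∀ {x y} → x ⋖ y → ∃[ j ] JI L bot top j × x ≤ κ j × j ≤ y
    label = cd⇒labelled cd (whole _) (whole _)

    ≤-from-D : ∀ {x v} → (∀ {d} → InDset L κ x d → d ≤ v) → x ≤ v
    ≤-from-D {x} {v} D≤v = decidable-stable (x ≤? v) λ x≰v →
      let x∧v<x = x∧y≤x x v , λ x∧v≡x → x≰v (subst (_≤ v) x∧v≡x (x∧y≤y _ _))
          (c , x∧v≤c , c⋖x) = cover-below x∧v<x
          (d , D , c≤κd , d≤x) = label c⋖x
          d≤v = D≤v (c , c⋖x , D , c≤κd , d≤x)
      in κ-irreflexive D (≤-trans (∧-greatest d≤x d≤v) (≤-trans x∧v≤c c≤κd))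

    ≤-from-U : ∀ {z v} → (∀ {i} → InUset L κ z i → v ≤ κ i) → v ≤ z
    ≤-from-U {z} {v} v≤κU = decidable-stable (v ≤? z) λ v≰z →
      let z<z∨v = x≤x∨y z v , λ z≡z∨v → v≰z (subst (v ≤_) (sym z≡z∨v) (y≤x∨y _ _))
          (c , z⋖c , c≤z∨v) = cover-above z<z∨v
          (i , I , z≤κi , i≤c) = label z⋖c
          v≤κi = v≤κU (c , z⋖c , I , z≤κi , i≤c)
      in κ-irreflexive I (≤-trans i≤c (≤-trans c≤z∨v (∨-least z≤κi v≤κi)))

  module PoppingPairs {κ : Carrier → Carrier} (cd : CD L bot top κ)
    (independent : ∀ x → Independent L κ (InDset L κ x) × Independent L κ (InUset L κ x)) where
    open CompatiblyDismantlable cd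

    D-independent : ∀ {x j j'} → InDset L κ x j → InDset L κ x j' → j ≢ j' → j ≤ κ j'
    D-independent {x} {j} {j'} j∈ j'∈ j≢j' =
      decidable-stable (j ≤? κ j') λ j≰κj' → proj₁ (independent x) j j' j∈ j'∈ (j≢j' , j≰κj')

    U-independent : ∀ {x j j'} → InUset L κ x j → InUset L κ x j' → j ≢ j' → j ≤ κ j'
    U-independent {x} {j} {j'} j∈ j'∈ j≢j' =
      decidable-stable (j ≤? κ j') λ j≰κj' → proj₂ (independent x) j j' j∈ j'∈ (j≢j' , j≰κj')

    -- Pop↓ x = (Pop↓ x ∨ j) ∧ κ j for every j ∈ D(x), and that element is covered by its join with j.
    D⊆U-popDown : ∀ {x p j} → PopDownIs L x p → InDset L κ x j → InUset L κ p j
    D⊆U-popDown {x} {p} {j} (p≤x , p≤lower , p-greatest) j∈D@(w , w⋖x , J , w≤κj , j≤x) =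
        p ∨ j
      , subst (λ c → c ⋖ c ∨ j) (sym p≡c) (cd⇒meetCovered cd J (whole _) (y≤x∨y p j))
      , J , p≤κj , y≤x∨y p j
      where
        p≤κj : p ≤ κ j
        p≤κj = ≤-trans (p≤lower w w⋖x) w≤κj
        p∨j≤x : p ∨ j ≤ x
        p∨j≤x = ∨-least p≤x j≤x
        c≤lower : ∀ w' → w' ⋖ x → (p ∨ j) ∧ κ j ≤ w'
        c≤lower w' w'⋖x with label w'⋖x
        ... | d , D , w'≤κd , d≤x with d ≟ j
        ...   | yes refl =
          subst (_ ≤_) (⋖⇒∧κ≡ D w'⋖x w'≤κd d≤x)
                (∧-greatest (≤-trans (x∧y≤x _ _) p∨j≤x) (x∧y≤y _ _))
        ...   | no d≢j =
          let j≤κd = D-independent j∈D (w' , w'⋖x , D , w'≤κd , d≤x) (d≢j ∘ sym)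
              j≤w' = subst (j ≤_) (⋖⇒∧κ≡ D w'⋖x w'≤κd d≤x) (∧-greatest j≤x j≤κd)
          in ≤-trans (x∧y≤x _ _) (∨-least (p≤lower w' w'⋖x) j≤w')
        p≡c : p ≡ (p ∨ j) ∧ κ j
        p≡c = antisym (∧-greatest (x≤x∨y _ _) p≤κj)
                      (p-greatest _ (≤-trans (x∧y≤x _ _) p∨j≤x) c≤lower)

    U⊆D-popUp : ∀ {x q j} → PopUpIs L x q → InUset L κ x j → InDset L κ q j
    U⊆D-popUp {x} {q} {j} (x≤q , upper≤q , q-least) j∈U@(v , x⋖v , J , x≤κj , j≤v) =
        q ∧ κ j
      , subst (λ c → c ∧ κ j ⋖ c) (sym q≡c) (cd⇒joinCovers cd J (whole _) (x∧y≤y q (κ j)))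
      , J , x∧y≤y _ _ , j≤q
      where
        j≤q : j ≤ q
        j≤q = ≤-trans j≤v (upper≤q v x⋖v)
        x≤q∧κj : x ≤ q ∧ κ j
        x≤q∧κj = ∧-greatest x≤q x≤κj
        upper≤c : ∀ v' → x ⋖ v' → v' ≤ (q ∧ κ j) ∨ j
        upper≤c v' x⋖v' with label x⋖v'
        ... | d , D , x≤κd , d≤v' with d ≟ j
        ...   | yes refl =
          subst (_≤ _) (⋖⇒∨≡ D x⋖v' x≤κd d≤v')
                (∨-least (≤-trans x≤q∧κj (x≤x∨y _ _)) (y≤x∨y _ _))
        ...   | no d≢j =
          let d≤κj = U-independent (v' , x⋖v' , D , x≤κd , d≤v') j∈U d≢j
              v'≤κj = subst (_≤ κ j) (⋖⇒∨≡ D x⋖v' x≤κd d≤v') (∨-least x≤κj d≤κj)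
          in ≤-trans (∧-greatest (upper≤q v' x⋖v') v'≤κj) (x≤x∨y _ _)
        q≡c : q ≡ (q ∧ κ j) ∨ j
        q≡c = antisym (q-least _ (≤-trans x≤q∧κj (x≤x∨y _ _)) upper≤c)
                      (∨-least (x∧y≤x _ _) j≤q)

    popDown-image⇒poppingPair : ∀ {x z} → PopDownIs L x z → ∃ (PoppingPair L z)
    popDown-image⇒poppingPair {x} {z} popDown[x]@(z≤x , _) =
      y , popUp[z] , z≤y , z≤lower , lower-greatest
      where
        y : Carrier
        y = proj₁ (popUp-exists z)
        popUp[z] : PopUpIs L z y
        popUp[z] = proj₂ (popUp-exists z)
        z≤y : z ≤ y
        z≤y = proj₁ popUp[z]
        z≤κD : ∀ {j} → InDset L κ y j → z ≤ κ j
        z≤κD {j} j∈D = decidable-stable (z ≤? κ j) λ z≰κj →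
          z≰κj (≤-trans z≤x (≤-from-D λ d∈Dx →
            let d∈Uz@(_ , _ , _ , z≤κd , _) = D⊆U-popDown popDown[x] d∈Dx
            in D-independent (U⊆D-popUp popUp[z] d∈Uz) j∈D
                 λ d≡j → z≰κj (subst (λ i → z ≤ κ i) d≡j z≤κd)))
        z≤lower : ∀ w → w ⋖ y → z ≤ w
        z≤lower w w⋖y =
          let (j , J , w≤κj , j≤y) = label w⋖y
          in subst (z ≤_) (⋖⇒∧κ≡ J w⋖y w≤κj j≤y)
                   (∧-greatest z≤y (z≤κD (w , w⋖y , J , w≤κj , j≤y)))
        lower-greatest : ∀ v → v ≤ y → (∀ w → w ⋖ y → v ≤ w) → v ≤ z
        lower-greatest v _ v≤lower = ≤-from-U λ i∈Uz →
          let (w , w⋖y , _ , w≤κi , _) = U⊆D-popUp popUp[z] i∈Uz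
          in ≤-trans (v≤lower w w⋖y) w≤κi

    popUp-image⇒poppingPair : ∀ {x z} → PopUpIs L x z → ∃ λ p → PoppingPair L p z
    popUp-image⇒poppingPair {x} {z} popUp[x]@(x≤z , _) =
      p , (p≤z , upper≤z , upper-least) , popDown[z]
      where
        p : Carrier
        p = proj₁ (popDown-exists z)
        popDown[z] : PopDownIs L z p
        popDown[z] = proj₂ (popDown-exists z)
        p≤z : p ≤ z
        p≤z = proj₁ popDown[z]
        U≤z : ∀ {j} → InUset L κ p j → j ≤ z
        U≤z {j} j∈U = decidable-stable (j ≤? z) λ j≰z →
          j≰z (≤-trans (≤-from-U λ d∈Ux →
            let d∈Dz@(_ , _ , _ , _ , d≤z) = U⊆D-popUp popUp[x] d∈Ux
            in U-independent j∈U (D⊆U-popDown popDown[z] d∈Dz)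
                 λ j≡d → j≰z (subst (_≤ z) (sym j≡d) d≤z)) x≤z)
        upper≤z : ∀ v → p ⋖ v → v ≤ z
        upper≤z v p⋖v =
          let (j , J , p≤κj , j≤v) = label p⋖v
          in subst (_≤ z) (⋖⇒∨≡ J p⋖v p≤κj j≤v)
                   (∨-least p≤z (U≤z (v , p⋖v , J , p≤κj , j≤v)))
        upper-least : ∀ w → p ≤ w → (∀ v → p ⋖ v → v ≤ w) → z ≤ w
        upper-least w _ upper≤w = ≤-from-D λ d∈Dz →
          let (c , p⋖c , _ , _ , d≤c) = D⊆U-popDown popDown[z] d∈Dz
          in ≤-trans d≤c (upper≤w c p⋖c)

proposition9p8 : (L : FiniteLattice) → Semidistrim L → (z : FiniteLattice.Carrier L) →
    ((∃ λ x → PopDownIs L x z) ⇔ (∃ λ y → PoppingPair L z y))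
    × ((∃ λ x → PopUpIs L x z) ⇔ (∃ λ x → PoppingPair L x z))
proposition9p8 L (κ , cd , independent) z =
    mk⇔ (λ (_ , popDown) → popDown-image⇒poppingPair popDown) (λ (y , _ , popDown) → y , popDown)
  , mk⇔ (λ (_ , popUp) → popUp-image⇒poppingPair popUp) (λ (x , popUp , _) → x , popUp)
  where open PoppingPairs L cd independent
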